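{- For all $n\ge 3$, with $T(n)$ and $L(n)$ as defined in the context, $$L(n-2)=\begin{cases}L(n) & \text{if the label } n \text{ is on a regular node},\\ L(n)-1 & \text{if } n \text{ is the first label on a leaf},\\ L(n)-2 & \text{if } n \text{ is the second label on a leaf},\\ L(n)-1 & \text{if } n \text{ is the third label on a leaf}.\end{cases}$$
   Context: Let $T$ be the following infinite binary tree, all of whose leaves lie on a single bottom level. There is a sequence of "s-nodes" $S_1,S_2,\dots$: $S_1$ has two children, both leaves; for $m\ge 2$, $S_m$ has left child $S_{m-1}$ and right child the root of a complete binary tree of the same height as the subtree rooted at $S_{m-1}$ (so the subtree rooted at each $S_m$ is a complete binary tree with all leaves on the bottom level). Nodes on the bottom level are leaves; each leaf has two cells (a left cell and a right cell). Nodes that are neither leaves nor s-nodes are regular nodes. For $n\ge0$, $T(n)$ is $T$ with labels $1,2,\dots,n$ inserted in preorder starting from the leftmost leaf (i.e. traversing the two leaf children of $S_1$, then the right subtree of $S_2$ in preorder, then the right subtree of $S_3$, etc.): s-nodes receive no label, each regular node receives one label, and each leaf receives three consecutive labels, the first in its left cell and the next two in its right cell (the last node reached may be only partially labelled). A cell is non-empty if it contains at least one label. $L(n)$ is the number of non-empty cells in $T(n)$. -}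

module Defs where

open import Data.Nat using (ℕ; zero; suc; _+_)
open import Data.List using (List; []; _∷_; _++_)
open import Data.List.Relation.Unary.Any using (Any)
open import Data.Product using (∃₂; Σ)
open import Relation.Binary.PropositionalEquality using (_≡_)

-- Kinds of nodes of T that receive labels (s-nodes receive none and are omitted).
data Node : Set where
  regular : Node
  leaf    : Node

-- Preorder of a complete binary tree of height h (h = 0: a single leaf).
complete : ℕ → List Node
complete zero    = leaf ∷ []
complete (suc h) = regular ∷ (complete h ++ complete h)

-- Labelled nodes of the subtree rooted at S_(m+1), in the labelling order:
-- the two leaves of S_1, then the right subtree of S_2 (complete, height 1),
-- then the right subtree of S_3 (height 2), ...  (s-nodes omitted).
sOrder : ℕ → List Node
sOrder zero    = leaf ∷ leaf ∷ []
sOrder (suc m) = sOrder m ++ complete (suc m)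

-- A node after labelling: a regular node with its label, or a leaf with the
-- contents of its left cell and its right cell.
data LNode : Set where
  regL  : ℕ → LNode
  leafL : List ℕ → List ℕ → LNode

fill : ℕ → ℕ → List Node → List LNode
fill k zero ns = []
fill k (suc r) [] = []
fill k (suc r) (regular ∷ ns) = regL k ∷ fill (suc k) r ns
fill k (suc zero) (leaf ∷ ns) = leafL (k ∷ []) [] ∷ []
fill k (suc (suc zero)) (leaf ∷ ns) = leafL (k ∷ []) (suc k ∷ []) ∷ []
fill k (suc (suc (suc r))) (leaf ∷ ns) =
  leafL (k ∷ []) (suc k ∷ suc (suc k) ∷ []) ∷ fill (suc (suc (suc k))) r ns

-- T(n): the labelled (nodes of the) tree.  The subtree at S_(n+1) has more
-- than n nodes, so all labels 1..n are placed; nodes not listed are unlabelled.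
T : ℕ → List LNode
T n = fill 1 n (sOrder n)

nonEmpty : List ℕ → ℕ
nonEmpty []      = 0
nonEmpty (_ ∷ _) = 1

cells : LNode → ℕ
cells (regL _)    = 0
cells (leafL l r) = nonEmpty l + nonEmpty r

countCells : List LNode → ℕ
countCells []       = 0
countCells (x ∷ xs) = cells x + countCells xs

L : ℕ → ℕ
L n = countCells (T n)

OnRegular : ℕ → Set
OnRegular n = Any (λ x → x ≡ regL n) (T n)

FirstOnLeaf : ℕ → Set
FirstOnLeaf n = Any (λ x → ∃₂ λ l r → x ≡ leafL (n ∷ l) r) (T n)

SecondOnLeaf : ℕ → Set
SecondOnLeaf n = Any (λ x → ∃₂ λ l r → x ≡ leafL l (n ∷ r)) (T n)

ThirdOnLeaf : ℕ → Set
ThirdOnLeaf n = Any (λ x → ∃₂ λ l a → Σ (List ℕ) λ r → x ≡ leafL l (a ∷ n ∷ r)) (T n)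

module Submission where

-- Labels are placed by `fill`, which walks the node list in
-- preorder: a regular node takes one label, a leaf takes three (one in its
-- left cell, two in its right cell).  Placing the last two labels j-1, j of
-- T(j) opens a number of new cells that depends only on the place of j:
-- on a regular node j-1 sits on a regular node or third in a leaf (0 new
-- cells); if j is first in a leaf, j-1 opened nothing and j opens the left
-- cell (1); if j is second, j-1 and j open both cells (2); if j is third,
-- j-1 opened the right cell (1).  Separately, T(n-2) agrees with the
-- first n-2 labels placed along the node order of T(n), because the node
-- order of S_(m+1) is a prefix of that of every later s-node
-- (`T-stable`).

open import Defs
open import Data.Nat using (ℕ; zero; suc; _+_; _∸_; _≤_; _<_; z≤n; s≤s)
open import Data.Nat.Properties
  using (+-comm; +-assoc; +-identityʳ; +-mono-≤; +-monoˡ-≤; m≤m+n; m≤n+m; n≤1+n; m+n≤o⇒n≤o; ≤-refl; <⇒≱; module ≤-Reasoning)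
open import Data.List using (List; []; _∷_; _++_; length)
open import Data.List.Properties using (length-++; ++-assoc; ++-identityʳ)
open import Data.List.Relation.Unary.Any using (Any; here; there)
open import Data.Product using (Σ; ∃; ∃₂; _×_; _,_)
open import Data.Empty using (⊥-elim)
open import Relation.Binary.PropositionalEquality using (_≡_; refl; sym; trans; cong; module ≡-Reasoning)

data Place : Set where
  regularNode firstOfLeaf secondOfLeaf thirdOfLeaf : Place

At : Place → ℕ → LNode → Set
At regularNode  j x = x ≡ regL j
At firstOfLeaf  j x = ∃₂ λ l r → x ≡ leafL (j ∷ l) r
At secondOfLeaf j x = ∃₂ λ l r → x ≡ leafL l (j ∷ r)
At thirdOfLeaf  j x = ∃₂ λ l a → Σ (List ℕ) λ r → x ≡ leafL l (a ∷ j ∷ r)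

-- Number of cells opened by the labels j-1 and j when j is at place p.
gain : Place → ℕ
gain regularNode  = 0
gain firstOfLeaf  = 1
gain secondOfLeaf = 2
gain thirdOfLeaf  = 1

-- Every node consumes at least one label, so r labels never reach past
-- the first r nodes.
fill-prefix : ∀ k r ns ms → r ≤ length ns → fill k r (ns ++ ms) ≡ fill k r ns
fill-prefix k zero ns ms _ = refl
fill-prefix k (suc r) [] ms ()
fill-prefix k (suc r) (regular ∷ ns) ms (s≤s r≤) =
  cong (regL k ∷_) (fill-prefix (suc k) r ns ms r≤)
fill-prefix k 1 (leaf ∷ ns) ms _ = refl
fill-prefix k 2 (leaf ∷ ns) ms _ = refl
fill-prefix k (suc (suc (suc r))) (leaf ∷ ns) ms (s≤s r≤) =
  cong (_ ∷_) (fill-prefix (3 + k) r ns ms (m+n≤o⇒n≤o 2 r≤))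

sOrder-length : ∀ m → m ≤ length (sOrder m)
sOrder-length zero = z≤n
sOrder-length (suc m) = begin
  suc m                                          ≡⟨ +-comm 1 m ⟩
  m + 1                                          ≤⟨ +-mono-≤ (sOrder-length m) (s≤s z≤n) ⟩
  length (sOrder m) + length (complete (suc m))  ≡⟨ sym (length-++ (sOrder m)) ⟩
  length (sOrder (suc m))                        ∎
  where open ≤-Reasoning

sOrder-extends : ∀ d m → ∃ λ ms → sOrder (d + m) ≡ sOrder m ++ ms
sOrder-extends zero m = [] , sym (++-identityʳ (sOrder m))
sOrder-extends (suc d) m with sOrder-extends d m
... | ms , extends = ms ++ complete (suc (d + m)) , (begin
  sOrder (d + m) ++ complete (suc (d + m))        ≡⟨ cong (_++ complete (suc (d + m))) extends ⟩
  (sOrder m ++ ms) ++ complete (suc (d + m))      ≡⟨ ++-assoc (sOrder m) ms _ ⟩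
  sOrder m ++ (ms ++ complete (suc (d + m)))      ∎)
  where open ≡-Reasoning

T-stable : ∀ d r → fill 1 r (sOrder (d + r)) ≡ T r
T-stable d r with sOrder-extends d r
... | ms , extends =
  trans (cong (fill 1 r) extends) (fill-prefix 1 r (sOrder r) ms (sOrder-length r))

-- A single label k lands on a regular node or in a left cell, which is
-- where `gain` counts 0 and 1 opened cells.
firstLabel-cells : ∀ p k ns → Any (At p k) (fill k 1 ns) → countCells (fill k 1 ns) ≡ gain p
firstLabel-cells p            k []             ()
firstLabel-cells regularNode  k (regular ∷ ns) _ = refl
firstLabel-cells firstOfLeaf  k (regular ∷ ns) (here (_ , _ , ()))
firstLabel-cells secondOfLeaf k (regular ∷ ns) (here (_ , _ , ()))
firstLabel-cells thirdOfLeaf  k (regular ∷ ns) (here (_ , _ , _ , ()))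
firstLabel-cells p            k (regular ∷ ns) (there ())
firstLabel-cells firstOfLeaf  k (leaf ∷ ns)    _ = refl
firstLabel-cells regularNode  k (leaf ∷ ns)    (here ())
firstLabel-cells secondOfLeaf k (leaf ∷ ns)    (here (_ , _ , ()))
firstLabel-cells thirdOfLeaf  k (leaf ∷ ns)    (here (_ , _ , _ , ()))
firstLabel-cells p            k (leaf ∷ ns)    (there ())

At-regL : ∀ p {j k} → At p j (regL k) → j ≤ k
At-regL regularNode  refl = ≤-refl
At-regL firstOfLeaf  (_ , _ , ())
At-regL secondOfLeaf (_ , _ , ())
At-regL thirdOfLeaf  (_ , _ , _ , ())

At-fullLeaf : ∀ p {j k} → At p j (leafL (k ∷ []) (suc k ∷ suc (suc k) ∷ [])) → j ≤ 2 + k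
At-fullLeaf regularNode  ()
At-fullLeaf firstOfLeaf  {k = k} (_ , _ , refl)     = m≤n+m k 2
At-fullLeaf secondOfLeaf {k = k} (_ , _ , refl)     = n≤1+n (suc k)
At-fullLeaf thirdOfLeaf  (_ , _ , _ , refl) = ≤-refl

-- If j = k + d + r + 1 then j > k + d: the last label of `fill k (2 + d + r)`
-- cannot sit on a leading node whose labels are at most k + d.
beyond : ∀ d k r {j} → j ≡ suc (d + r + k) → d + k < j
beyond d k r refl = s≤s (+-monoˡ-≤ k (m≤m+n d r))

-- Passing over a node that took d labels shifts the starting label by d.
relabel : ∀ d r k {j} → j ≡ suc (d + r + k) → j ≡ suc (r + (d + k))
relabel d r k j≡ = trans j≡ (cong suc (trans (cong (_+ k) (+-comm d r)) (+-assoc r d k)))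

lastLabel-cells : ∀ p k r j ns → j ≡ suc (r + k) → Any (At p j) (fill k (2 + r) ns) →
  countCells (fill k r ns) + gain p ≡ countCells (fill k (2 + r) ns)
lastLabel-cells p k r j [] _ ()
lastLabel-cells p k r j (regular ∷ ns) j≡ (here x) =
  ⊥-elim (<⇒≱ (beyond 0 k r j≡) (At-regL p x))
lastLabel-cells p k zero j (regular ∷ ns) refl (there a) =
  sym (firstLabel-cells p (suc k) ns a)
lastLabel-cells p k (suc r) j (regular ∷ ns) j≡ (there a) =
  lastLabel-cells p (suc k) r j ns (relabel 1 r k j≡) a
lastLabel-cells regularNode  k 0 j (leaf ∷ ns) _ (here ())
lastLabel-cells firstOfLeaf  k 0 j (leaf ∷ ns) j≡ (here (_ , _ , refl)) =
  ⊥-elim (<⇒≱ (beyond 0 k 0 j≡) ≤-refl)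
lastLabel-cells secondOfLeaf k 0 j (leaf ∷ ns) _ (here (_ , _ , refl)) = refl
lastLabel-cells thirdOfLeaf  k 0 j (leaf ∷ ns) _ (here (_ , _ , _ , ()))
lastLabel-cells regularNode  k 1 j (leaf ∷ ns) _ (here ())
lastLabel-cells firstOfLeaf  k 1 j (leaf ∷ ns) j≡ (here (_ , _ , refl)) =
  ⊥-elim (<⇒≱ (beyond 0 k 1 j≡) ≤-refl)
lastLabel-cells secondOfLeaf k 1 j (leaf ∷ ns) j≡ (here (_ , _ , refl)) =
  ⊥-elim (<⇒≱ (beyond 1 k 0 j≡) ≤-refl)
lastLabel-cells thirdOfLeaf  k 1 j (leaf ∷ ns) _ (here (_ , _ , _ , refl)) = refl
lastLabel-cells p k (suc (suc r)) j (leaf ∷ ns) j≡ (here x) =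
  ⊥-elim (<⇒≱ (beyond 2 k r j≡) (At-fullLeaf p x))
lastLabel-cells p k 0 j (leaf ∷ ns) _ (there ())
lastLabel-cells p k 1 j (leaf ∷ ns) _ (there ())
lastLabel-cells p k 2 j (leaf ∷ ns) refl (there a) =
  cong (2 +_) (sym (firstLabel-cells p (3 + k) ns a))
lastLabel-cells p k (suc (suc (suc r))) j (leaf ∷ ns) j≡ (there a) =
  cong (2 +_) (lastLabel-cells p (3 + k) r j ns (relabel 3 r k j≡) a)

lemma3p2 : (n : ℕ) → 3 ≤ n →
    (OnRegular n → L (n ∸ 2) ≡ L n) ×
    (FirstOnLeaf n → L (n ∸ 2) + 1 ≡ L n) ×
    (SecondOnLeaf n → L (n ∸ 2) + 2 ≡ L n) ×
    (ThirdOnLeaf n → L (n ∸ 2) + 1 ≡ L n)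
lemma3p2 zero ()
lemma3p2 (suc zero) (s≤s ())
lemma3p2 (suc (suc r)) _ =
    (λ a → trans (sym (+-identityʳ (L r))) (lastTwo regularNode a))
  , lastTwo firstOfLeaf , lastTwo secondOfLeaf , lastTwo thirdOfLeaf
  where
    lastTwo : ∀ p → Any (At p (2 + r)) (T (2 + r)) → L r + gain p ≡ L (2 + r)
    lastTwo p a = begin
      L r + gain p                                      ≡⟨ cong (λ ts → countCells ts + gain p) (sym (T-stable 2 r)) ⟩
      countCells (fill 1 r (sOrder (2 + r))) + gain p   ≡⟨ lastLabel-cells p 1 r (2 + r) (sOrder (2 + r)) (cong suc (+-comm 1 r)) a ⟩
      L (2 + r)                                         ∎
      where open ≡-Reasoning
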